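{- Every modal semiring whose test algebra is a complete lattice is a divergence semiring. Every modal Kleene algebra whose test algebra is a complete lattice is a divergence Kleene algebra.
   Context: An idempotent semiring is a structure $(S,+,\cdot,0,1)$ such that $(S,+,0)$ is a commutative monoid with $a+a=a$, $(S,\cdot,1)$ is a monoid, multiplication distributes over addition from both sides, and $0a=a0=0$; natural order $a\le b\iff a+b=b$. A test is an element $p\le 1$ for which some $q$ satisfies $p+q=1$ and $pq=0=qp$; $q$ is unique, written $\neg p$; tests form a Boolean algebra $\mathrm{test}(S)$ ordered by the natural order. $S$ is a modal semiring if for each $a\in S$ there are maps $|a\rangle,\langle a|$ on $\mathrm{test}(S)$ with, for all $a,b,p,q$: $|a\rangle p\le q\iff \neg q\,a\,p\le 0$; $\langle a|p\le q\iff p\,a\,\neg q\le 0$; $|ab\rangle p=|a\rangle(|b\rangle p)$; $\langle ab|p=\langle b|(\langle a|p)$. A Kleene algebra is an idempotent semiring with ${}^*$ such that $1+aa^*\le a^*$, $b+ac\le c\Rightarrow a^*b\le c$, $1+a^*a\le a^*$, $b+ca\le c\Rightarrow ba^*\le c$; a modal Kleene algebra is a Kleene algebra that is a modal semiring. For $a$ in a modal semiring, a test $\nabla a$ is the divergence of $a$ if $\nabla a\le|a\rangle\nabla a$ and for every test $p$, $p\le|a\rangle p\Rightarrow p\le\nabla a$. A divergence semiring is a modal semiring in which $\nabla a$ exists for all $a$; a divergence Kleene algebra is a divergence semiring that is a Kleene algebra. -}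

module Defs where

open import Level using (Level; suc; _⊔_)
open import Data.Product using (Σ; Σ-syntax; _×_; _,_; proj₁; proj₂)
open import Function.Bundles using (_⇔_)
open import Relation.Binary.PropositionalEquality using (_≡_)

record IdempotentSemiring (c : Level) : Set (suc c) where
  infixl 6 _+_
  infixl 7 _·_
  infix 4 _≤_
  field
    Carrier : Set c
    _+_ _·_ : Carrier → Carrier → Carrier
    𝟘 𝟙 : Carrier
    +-assoc : ∀ a b d → (a + b) + d ≡ a + (b + d)
    +-comm : ∀ a b → a + b ≡ b + a
    +-identityˡ : ∀ a → 𝟘 + a ≡ a
    +-idem : ∀ a → a + a ≡ a
    ·-assoc : ∀ a b d → (a · b) · d ≡ a · (b · d)
    ·-identityˡ : ∀ a → 𝟙 · a ≡ a
    ·-identityʳ : ∀ a → a · 𝟙 ≡ a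
    distribˡ : ∀ a b d → a · (b + d) ≡ a · b + a · d
    distribʳ : ∀ a b d → (b + d) · a ≡ b · a + d · a
    zeroˡ : ∀ a → 𝟘 · a ≡ 𝟘
    zeroʳ : ∀ a → a · 𝟘 ≡ 𝟘

  _≤_ : Carrier → Carrier → Set c
  a ≤ b = a + b ≡ b

  IsComplement : Carrier → Carrier → Set c
  IsComplement p q = (p + q ≡ 𝟙) × (p · q ≡ 𝟘) × (q · p ≡ 𝟘)

  IsTest : Carrier → Set c
  IsTest p = (p ≤ 𝟙) × Σ[ q ∈ Carrier ] IsComplement p q

  Test : Set c
  Test = Σ[ p ∈ Carrier ] IsTest p

  ⌜_⌝ : Test → Carrier
  ⌜ t ⌝ = proj₁ t

  -- ¬p (the complement witness, unique by the semiring laws)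
  neg : Test → Carrier
  neg t = proj₁ (proj₂ (proj₂ t))

record ModalSemiring (c : Level) : Set (suc c) where
  field
    semiring : IdempotentSemiring c
  open IdempotentSemiring semiring public
  field
    fdia : Carrier → Test → Test
    bdia : Carrier → Test → Test
    fdia-adj : ∀ a p q → (⌜ fdia a p ⌝ ≤ ⌜ q ⌝) ⇔ (neg q · a · ⌜ p ⌝ ≤ 𝟘)
    bdia-adj : ∀ a p q → (⌜ bdia a p ⌝ ≤ ⌜ q ⌝) ⇔ (⌜ p ⌝ · a · neg q ≤ 𝟘)
    fdia-· : ∀ a b p → ⌜ fdia (a · b) p ⌝ ≡ ⌜ fdia a (fdia b p) ⌝
    bdia-· : ∀ a b p → ⌜ bdia (a · b) p ⌝ ≡ ⌜ bdia b (bdia a p) ⌝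

record ModalKleeneAlgebra (c : Level) : Set (suc c) where
  field
    modalSemiring : ModalSemiring c
  open ModalSemiring modalSemiring public
  field
    _⋆ : Carrier → Carrier
    ⋆-unfoldˡ : ∀ a → 𝟙 + a · (a ⋆) ≤ a ⋆
    ⋆-inductˡ : ∀ a b d → b + a · d ≤ d → (a ⋆) · b ≤ d
    ⋆-unfoldʳ : ∀ a → 𝟙 + (a ⋆) · a ≤ a ⋆
    ⋆-inductʳ : ∀ a b d → b + d · a ≤ d → b · (a ⋆) ≤ d

module _ {c : Level} (M : ModalSemiring c) where
  open ModalSemiring M

  IsSupremum : (Test → Set c) → Test → Set c
  IsSupremum P s = (∀ p → P p → ⌜ p ⌝ ≤ ⌜ s ⌝)
                 × (∀ u → (∀ p → P p → ⌜ p ⌝ ≤ ⌜ u ⌝) → ⌜ s ⌝ ≤ ⌜ u ⌝)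

  TestsComplete : Set (suc c)
  TestsComplete = ∀ (P : Test → Set c) → Σ[ s ∈ Test ] IsSupremum P s

  IsDivergence : Carrier → Test → Set c
  IsDivergence a d = (⌜ d ⌝ ≤ ⌜ fdia a d ⌝)
                   × (∀ p → ⌜ p ⌝ ≤ ⌜ fdia a p ⌝ → ⌜ p ⌝ ≤ ⌜ d ⌝)

  IsDivergenceSemiring : Set c
  IsDivergenceSemiring = ∀ a → Σ[ d ∈ Test ] IsDivergence a d

IsDivergenceKleeneAlgebra : {c : Level} → ModalKleeneAlgebra c → Set c
IsDivergenceKleeneAlgebra K = IsDivergenceSemiring (ModalKleeneAlgebra.modalSemiring K)

module Submission where

-- The divergence ∇a is by definition the greatest post-fixed point of the
-- forward diamond |a⟩ on the test algebra.  The proof has three steps: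
--   1. in an idempotent semiring the natural order is a preorder and
--      multiplication is monotone;
--   2. in a modal semiring every forward diamond |a⟩ is monotone on tests,
--      which follows from its adjunction |a⟩p ≤ q ⇔ ¬q·a·p ≤ 0;
--   3. (Knaster–Tarski) for any monotone map f on tests, a supremum of the
--      post-fixed points {p | p ≤ f p} is the greatest post-fixed point of f.
-- When the tests form a complete lattice this supremum exists, so taking
-- f = |a⟩ yields ∇a for every a.

open import Defs
open import Level using (Level)
open import Data.Product using (_×_; _,_)
open import Function.Bundles using (Equivalence)
open import Relation.Binary.PropositionalEquality using (_≡_; sym; trans; cong)

module NaturalOrder {c : Level} (S : IdempotentSemiring c) where
  open IdempotentSemiring S

  ≤-refl : ∀ x → x ≤ x
  ≤-refl = +-idem

  -- Transitivity: x + z = x + (y + z) = (x + y) + z = y + z = z.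
  ≤-trans : ∀ {x y z} → x ≤ y → y ≤ z → x ≤ z
  ≤-trans {x} {y} {z} x≤y y≤z =
    trans (cong (x +_) (sym y≤z))
      (trans (sym (+-assoc x y z))
        (trans (cong (_+ z) x≤y) y≤z))

  ·-monoʳ : ∀ w {x y} → x ≤ y → w · x ≤ w · y
  ·-monoʳ w {x} {y} x≤y = trans (sym (distribˡ w x y)) (cong (w ·_) x≤y)

module ModalFixpoints {c : Level} (M : ModalSemiring c) where
  open ModalSemiring M
  open NaturalOrder semiring

  Monotone : (Test → Test) → Set c
  Monotone f = ∀ p q → ⌜ p ⌝ ≤ ⌜ q ⌝ → ⌜ f p ⌝ ≤ ⌜ f q ⌝

  -- The forward diamond is monotone: from |a⟩q ≤ |a⟩q the adjunction gives
  -- ¬(|a⟩q)·a·q ≤ 0, hence ¬(|a⟩q)·a·p ≤ 0 for p ≤ q, i.e. |a⟩p ≤ |a⟩q.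
  fdia-monotone : ∀ a → Monotone (fdia a)
  fdia-monotone a p q p≤q =
    Equivalence.from (fdia-adj a p r)
      (≤-trans (·-monoʳ (neg r · a) p≤q)
               (Equivalence.to (fdia-adj a q r) (≤-refl ⌜ r ⌝)))
    where
    r : Test
    r = fdia a q

  PostFixed : (Test → Test) → Test → Set c
  PostFixed f p = ⌜ p ⌝ ≤ ⌜ f p ⌝

  IsGreatestPostFixed : (Test → Test) → Test → Set c
  IsGreatestPostFixed f d = PostFixed f d × (∀ p → PostFixed f p → ⌜ p ⌝ ≤ ⌜ d ⌝)

  -- Knaster–Tarski: a supremum s of the post-fixed points of a monotone f is
  -- itself post-fixed, since every post-fixed p satisfies p ≤ f p ≤ f s,
  -- making f s an upper bound; and it lies above all of them by definition.
  supremum-is-greatest-post-fixed : ∀ f → Monotone f → ∀ s →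
    IsSupremum M (PostFixed f) s → IsGreatestPostFixed f s
  supremum-is-greatest-post-fixed f f-mono s (upper , least) =
    least (f s) (λ p p≤fp → ≤-trans p≤fp (f-mono p s (upper p p≤fp))) , upper

  divergence-from-completeness : TestsComplete M → IsDivergenceSemiring M
  divergence-from-completeness complete a =
    let (s , s-sup) = complete (PostFixed (fdia a))
    in s , supremum-is-greatest-post-fixed (fdia a) (fdia-monotone a) s s-sup

open ModalFixpoints using (divergence-from-completeness)

lemma7p4 : {c : Level} →
    ((M : ModalSemiring c) → TestsComplete M → IsDivergenceSemiring M)
    × ((K : ModalKleeneAlgebra c) → TestsComplete (ModalKleeneAlgebra.modalSemiring K) → IsDivergenceKleeneAlgebra K)
lemma7p4 =
  divergence-from-completeness ,
  λ K → divergence-from-completeness (ModalKleeneAlgebra.modalSemiring K)
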